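{- Let $P_0$ be a valid partition of $V$ (in the setting described in the context), and let $p_0$ denote the percentile of $S^*$ under $P_0$. There exists a valid partition coarser than $P_0$ (and still containing $S^*$ as a part) under which the percentile of $S^*$ is strictly less than $p_0$ (respectively, strictly greater than $p_0$) if and only if there exist $l$ large parts, $m$ medium parts and $s$ small parts of $P_0$, with $l+m+s\ge 2$, whose union belongs to $\mathcal{S}$ and such that $$\frac{l+\tfrac12 m-1}{l+m+s-1}$$ is strictly greater than $p_0$ (respectively, strictly less than $p_0$).
   Context: $V$ is a finite set and $E\subseteq V\times V$ a reflexive symmetric relation, viewed as a simple undirected graph $G=(V,E)$. $\mathcal{S}$ denotes the family of nonempty subsets $S\subseteq V$ that are connected in $G$ (the induced subgraph $G[S]$ is connected). $\mu:2^V\to[0,\infty)$ is additive, $\mu(S)=\sum_{s\in S}\mu(\{s\})$, with $\mu(\{v\})>0$ for every $v\in V$. $S^*\in\mathcal{S}\cup\{\emptyset\}$ is a designated subset. A valid partition is a partition $(S_1,\dots,S_c,S^*)$ of $V$ with $S_1,\dots,S_c\in\mathcal{S}$. A set $S\in\mathcal{S}\setminus\{S^*\}$ is large if $\mu(S)>\mu(S^*)$, medium if $\mu(S)=\mu(S^*)$, small if $\mu(S)<\mu(S^*)$. The percentile of $S^*$ under a valid partition $(S_1,\dots,S_c,S^*)$ is $\frac{|\{i:\mu(S_i)>\mu(S^*)\}|+\frac12|\{i:\mu(S_i)=\mu(S^*)\}|+\frac12}{c+1}$.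
   Formalization: The measure μ takes values in the nonnegative rationals instead of $[0,\infty)$, with a positive rational weight on each vertex. -}

module Defs where

open import Data.Nat using (ℕ; zero; suc)
open import Data.Integer using (+_)
open import Data.Fin using (Fin)
open import Data.Fin.Properties using () renaming (_≟_ to _≟ᶠ_)
open import Data.Fin.Subset using (Subset; _∈_; _⊆_; Nonempty; inside; outside)
open import Data.Fin.Subset.Properties using (_∈?_)
open import Data.Vec using (tabulate)
open import Data.List using (List; length; filter; foldr)
open import Data.List.Base using (allFin; map)
open import Data.Maybe using (Maybe; just; nothing)
open import Data.Maybe.Properties using (≡-dec)
open import Data.Bool using (Bool; true; false; if_then_else_)
open import Data.Product using (Σ; ∃; _×_; _,_)
open import Data.Rational using (ℚ; 0ℚ; 1ℚ; ½; _+_; _*_; _-_; _/_; _÷_; _<_; ≢-nonZero)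
open import Data.Rational.Properties using (_≟_; _<?_)
open import Relation.Nullary using (yes; no; ¬_; Dec)
open import Relation.Nullary.Decidable using (⌊_⌋; _×-dec_)
open import Relation.Binary.PropositionalEquality using (_≡_)
open import Function.Bundles using (_⇔_)

ℕ→ℚ : ℕ → ℚ
ℕ→ℚ k = + k / 1

-- Division with the (irrelevant) convention q / 0 = 0; only ever used
-- with a nonzero denominator in the statement.
_÷'_ : ℚ → ℚ → ℚ
p ÷' q with q ≟ 0ℚ
... | yes _ = 0ℚ
... | no q≢0 = _÷_ p q {{≢-nonZero q≢0}}

module _ {n : ℕ} where

  measure : (Fin n → ℚ) → Subset n → ℚ
  measure μ S = foldr _+_ 0ℚ (map (λ v → if ⌊ v ∈? S ⌋ then μ v else 0ℚ) (allFin n))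

  -- Walks in the induced subgraph G[S] (the start vertex is assumed in S).
  data Walk (E : Fin n → Fin n → Set) (S : Subset n) : Fin n → Fin n → Set where
    here : ∀ {u} → Walk E S u u
    step : ∀ {u v w} → E u v → v ∈ S → Walk E S v w → Walk E S u w

  -- S ∈ 𝒮 : nonempty and G[S] connected.
  Connected : (Fin n → Fin n → Set) → Subset n → Set
  Connected E S = Nonempty S × (∀ u v → u ∈ S → v ∈ S → Walk E S u v)

  partOf : {c : ℕ} → (Fin n → Maybe (Fin c)) → Fin c → Subset n
  partOf lab i = tabulate (λ v → ⌊ ≡-dec _≟ᶠ_ (lab v) (just i) ⌋)

  unionOf : {c : ℕ} → (Fin n → Maybe (Fin c)) → Subset c → Subset n
  unionOf {c} lab T = tabulate λ v → f (lab v)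
    where
      f : Maybe (Fin c) → Bool
      f (just i) = ⌊ i ∈? T ⌋
      f nothing  = false

  -- A valid partition (S_1,…,S_c,S*): each vertex is labelled by the index
  -- of its part, or by `nothing` exactly when it lies in S*; each part
  -- S_i = partOf lab i belongs to 𝒮.
  record ValidPartition (E : Fin n → Fin n → Set) (S* : Subset n) : Set where
    field
      c         : ℕ
      lab       : Fin n → Maybe (Fin c)
      lab-S*    : ∀ v → (v ∈ S* ⇔ lab v ≡ nothing)
      part-conn : ∀ i → Connected E (partOf lab i)

  open ValidPartition public

  part : {E : Fin n → Fin n → Set} {S* : Subset n} (P : ValidPartition E S*) → Fin (c P) → Subset n
  part P = partOf (lab P)

  union : {E : Fin n → Fin n → Set} {S* : Subset n} (P : ValidPartition E S*) → Subset (c P) → Subset n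
  union P = unionOf (lab P)

  module _ {E : Fin n → Fin n → Set} {S* : Subset n} (μ : Fin n → ℚ) (P : ValidPartition E S*) where

    nLarge nMedium nSmall : Subset (c P) → ℕ
    nLarge  T = length (filter (λ i → (i ∈? T) ×-dec (measure μ S* <? measure μ (part P i))) (allFin (c P)))
    nMedium T = length (filter (λ i → (i ∈? T) ×-dec (measure μ (part P i) ≟ measure μ S*)) (allFin (c P)))
    nSmall  T = length (filter (λ i → (i ∈? T) ×-dec (measure μ (part P i) <? measure μ S*)) (allFin (c P)))

    allParts : Subset (c P)
    allParts = tabulate (λ _ → true)

    percentile : ℚ
    percentile = (ℕ→ℚ (nLarge allParts) + ½ * ℕ→ℚ (nMedium allParts) + ½) ÷' ℕ→ℚ (suc (c P))

  -- Q is coarser than P: every part of P is contained in some part of Q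
  -- (S* is a part of both by definition of a valid partition).
  Coarser : {E : Fin n → Fin n → Set} {S* : Subset n} → ValidPartition E S* → ValidPartition E S* → Set
  Coarser P Q = ∀ i → ∃ λ j → part P i ⊆ part Q j

mergeRatio : ℕ → ℕ → ℕ → ℚ
mergeRatio l m s = (ℕ→ℚ l + ½ * ℕ→ℚ m - 1ℚ) ÷' (ℕ→ℚ l + ℕ→ℚ m + ℕ→ℚ s - 1ℚ)

{-# OPTIONS --safe #-}

-- Write weight S ∈ {2, 1, 0} for twice the contribution of a large, medium or small part
-- to the percentile count, so that a valid partition P with c parts P₁ … P_c has percentile
-- (Σᵢ weight Pᵢ + 1) / 2(c + 1).  Let Q be coarser than P.  The fibre of a part Q_j is the
-- set of parts of P inside it; say it has k_j members of total weight W_j.  With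
-- a = Σᵢ weight Pᵢ + 1 and b = c + 1, cross-multiplying turns percentile Q < percentile P
-- into Σ_j (a k_j + b · weight Q_j) < Σ_j (a + b W_j), a comparison of coarseTerm and
-- fineTerm summed over the fibres.  Singleton fibres contribute equally to both sides.  In a
-- fibre with at least two members each member is strictly lighter than Q_j, so either Q_j is
-- large or all members are small; either way the fibre's coarseTerm is below its fineTerm
-- exactly when percentile P is below the fibre's mergeRatio.  So some fibre is a set of parts
-- as in the statement; conversely, merging just the parts of such a set gives a coarsening
-- whose only non-singleton fibre is that set.  Raising the percentile is symmetric.

module Submission where

open import Defs

open import Data.Nat as ℕ using (ℕ; zero; suc; _+_; _*_; _≤_; z≤n; s≤s)
open import Data.Nat using () renaming (_+_ to _+ℕ_)
import Data.Nat.Properties as ℕ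
open import Data.Nat.Solver using () renaming (module +-*-Solver to ℕ-Solver)
import Data.Integer as ℤ
import Data.Integer.Properties as ℤ
open import Data.Rational as ℚ using (ℚ; 0ℚ; 1ℚ; ½; _<_; toℚᵘ)
import Data.Rational.Properties as ℚ
open import Data.Rational.Solver using (module +-*-Solver)
open import Data.Rational.Unnormalised as ℚᵘ using (ℚᵘ; mkℚᵘ; *≡*; *<*) renaming (_≃_ to _≃ᵘ_)
import Data.Rational.Unnormalised.Properties as ℚᵘ
open import Data.Fin as Fin using (Fin; zero; suc; punchIn; punchOut)
open import Data.Fin.Properties using (any?; punchIn-punchOut; punchInᵢ≢i; punchIn-injective)
open import Data.Fin.Subset using (Subset; Empty; _∈_; _∉_; _⊆_; ∣_∣; ∁; inside; outside)
open import Data.Fin.Subset.Properties using (_∈?_; ⊆-antisym; drop-there)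
open import Data.Vec as Vec using (_∷_; here; there)
import Data.Vec.Properties as Vec
open import Data.Vec.Functional using (Vector; removeAt)
open import Data.List as List using ([]; _∷_; foldr; length; filter)
open import Data.List.Relation.Unary.Any using (here; there)
open import Data.List.Membership.Propositional using () renaming (_∈_ to _∈ₗ_)
open import Data.List.Membership.Propositional.Properties using (∈-allFin)
open import Data.Maybe as Maybe using (Maybe; just; nothing)
open import Data.Maybe.Properties using (just-injective)
open import Data.Bool using (Bool; true; false; if_then_else_)
open import Data.Product using (_,_; ∃; _×_; proj₁; proj₂)
open import Data.Sum using (_⊎_; inj₁; inj₂)
open import Data.Empty using (⊥-elim)
open import Algebra.Properties.Semiring.Sum ℕ.+-*-semiring
  using (sum; sum-syntax; sum-remove; sum-cong-≗; sum-replicate-zero; ∑-distrib-+; ∑-comm; *-distribˡ-sum; *-distribʳ-sum)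
open import Relation.Binary.Definitions using (Reflexive; Symmetric; tri<; tri≈; tri>)
open import Relation.Binary.PropositionalEquality
open import Relation.Unary using (Pred; Decidable)
open import Relation.Nullary using (yes; no)
open import Relation.Nullary.Decidable using (Dec; does; ⌊_⌋; ¬?; dec-true; dec-false; _×-dec_)
open import Relation.Nullary.Negation using (¬_)
open import Function using (_∘_)
open import Function.Bundles using (_⇔_; mk⇔; module Equivalence)
open Equivalence using (to; from)
open import Function.Properties.Equivalence using () renaming (trans to infixr 4 _⟨⇔⟩_; sym to ⇔-sym)

private variable k m n : ℕ

-- Rational arithmetic of percentiles and merge ratios

private
  ℕ→ℚᵘ : ℕ → ℚᵘ
  ℕ→ℚᵘ k = mkℚᵘ (ℤ.+ k) 0

  toℚᵘ-ℕ→ℚ : ∀ k → toℚᵘ (ℕ→ℚ k) ≃ᵘ ℕ→ℚᵘ k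
  toℚᵘ-ℕ→ℚ k = ℚ.toℚᵘ-fromℚᵘ (ℕ→ℚᵘ k)

ℕ→ℚ-homo-+ : ∀ a b → ℕ→ℚ (a + b) ≡ ℕ→ℚ a ℚ.+ ℕ→ℚ b
ℕ→ℚ-homo-+ a b = ℚ.toℚᵘ-injective (begin
  toℚᵘ (ℕ→ℚ (a + b))                          ≈⟨ toℚᵘ-ℕ→ℚ (a + b) ⟩
  ℕ→ℚᵘ (a + b)                                ≈⟨ *≡* (cong (ℤ._* ℤ.+ 1) ℕ→ℤ+) ⟩
  ℕ→ℚᵘ a ℚᵘ.+ ℕ→ℚᵘ b                          ≈⟨ ℚᵘ.+-cong (toℚᵘ-ℕ→ℚ a) (toℚᵘ-ℕ→ℚ b) ⟨
  toℚᵘ (ℕ→ℚ a) ℚᵘ.+ toℚᵘ (ℕ→ℚ b)              ≈⟨ ℚ.toℚᵘ-homo-+ (ℕ→ℚ a) (ℕ→ℚ b) ⟨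
  toℚᵘ (ℕ→ℚ a ℚ.+ ℕ→ℚ b)                     ∎)
  where
  open ℚᵘ.≃-Reasoning
  ℕ→ℤ+ : ℤ.+ (a + b) ≡ ℤ.+ a ℤ.* ℤ.+ 1 ℤ.+ ℤ.+ b ℤ.* ℤ.+ 1
  ℕ→ℤ+ = trans (ℤ.pos-+ a b) (sym (cong₂ ℤ._+_ (ℤ.*-identityʳ (ℤ.+ a)) (ℤ.*-identityʳ (ℤ.+ b))))

ℕ→ℚ-homo-* : ∀ a b → ℕ→ℚ (a * b) ≡ ℕ→ℚ a ℚ.* ℕ→ℚ b
ℕ→ℚ-homo-* a b = ℚ.toℚᵘ-injective (begin
  toℚᵘ (ℕ→ℚ (a * b))                          ≈⟨ toℚᵘ-ℕ→ℚ (a * b) ⟩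
  ℕ→ℚᵘ (a * b)                                ≈⟨ *≡* (cong (ℤ._* ℤ.+ 1) (ℤ.pos-* a b)) ⟩
  ℕ→ℚᵘ a ℚᵘ.* ℕ→ℚᵘ b                          ≈⟨ ℚᵘ.*-cong (toℚᵘ-ℕ→ℚ a) (toℚᵘ-ℕ→ℚ b) ⟨
  toℚᵘ (ℕ→ℚ a) ℚᵘ.* toℚᵘ (ℕ→ℚ b)              ≈⟨ ℚ.toℚᵘ-homo-* (ℕ→ℚ a) (ℕ→ℚ b) ⟨
  toℚᵘ (ℕ→ℚ a ℚ.* ℕ→ℚ b)                     ∎)
  where open ℚᵘ.≃-Reasoning

ℕ→ℚ<ℕ→ℚ⇔< : ∀ {a b} → ℕ→ℚ a < ℕ→ℚ b ⇔ a ℕ.< b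
ℕ→ℚ<ℕ→ℚ⇔< {a} {b} = mk⇔ cancel mono
  where
  cancel : ℕ→ℚ a < ℕ→ℚ b → a ℕ.< b
  cancel lt with ℚᵘ.<-respˡ-≃ (toℚᵘ-ℕ→ℚ a) (ℚᵘ.<-respʳ-≃ (toℚᵘ-ℕ→ℚ b) (ℚ.toℚᵘ-mono-< lt))
  ... | *<* a*1<b*1 = ℤ.drop‿+<+ (ℤ.*-cancelʳ-<-nonNeg (ℤ.+ 1) a*1<b*1)
  mono : a ℕ.< b → ℕ→ℚ a < ℕ→ℚ b
  mono a<b = ℚ.toℚᵘ-cancel-<
    (ℚᵘ.<-respˡ-≃ (ℚᵘ.≃-sym (toℚᵘ-ℕ→ℚ a)) (ℚᵘ.<-respʳ-≃ (ℚᵘ.≃-sym (toℚᵘ-ℕ→ℚ b))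
      (*<* (ℤ.*-monoʳ-<-pos (ℤ.+ 1) (ℤ.+<+ a<b)))))

+-cancelʳ-< : ∀ z {x y} → x ℚ.+ z < y ℚ.+ z → x < y
+-cancelʳ-< z {x} {y} lt = subst₂ _<_ (undo x) (undo y) (ℚ.+-monoˡ-< (ℚ.- z) lt)
  where
  open +-*-Solver
  undo : ∀ w → w ℚ.+ z ℚ.- z ≡ w
  undo w = solve 2 (λ w z → w :+ z :- z := w) refl w z

<⇔<-halves : ∀ {x y z a b} → x ℚ.+ z ≡ ½ ℚ.* ℕ→ℚ a → y ℚ.+ z ≡ ½ ℚ.* ℕ→ℚ b → x < y ⇔ a ℕ.< b
<⇔<-halves {x} {y} {z} {a} {b} x+z≡a/2 y+z≡b/2 = mk⇔
  (λ x<y → to ℕ→ℚ<ℕ→ℚ⇔< (ℚ.*-cancelˡ-<-nonNeg ½ (subst₂ _<_ x+z≡a/2 y+z≡b/2 (ℚ.+-monoˡ-< z x<y))))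
  (λ a<b → +-cancelʳ-< z (subst₂ _<_ (sym x+z≡a/2) (sym y+z≡b/2)
                                      (ℚ.*-monoʳ-<-pos ½ (from ℕ→ℚ<ℕ→ℚ⇔< a<b))))

÷'-*-cancel : ∀ x {y} → 0ℚ < y → (x ÷' y) ℚ.* y ≡ x
÷'-*-cancel x {y} 0<y with y ℚ.≟ 0ℚ
... | yes refl = ⊥-elim (ℚ.<-irrefl refl 0<y)
... | no y≢0 = begin
  x ℚ.* ℚ.1/ y ℚ.* y   ≡⟨ ℚ.*-assoc x _ y ⟩
  x ℚ.* (ℚ.1/ y ℚ.* y) ≡⟨ cong (x ℚ.*_) (ℚ.*-inverseˡ y) ⟩
  x ℚ.* 1ℚ             ≡⟨ ℚ.*-identityʳ x ⟩
  x                    ∎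
  where
  open ≡-Reasoning
  instance _ = ℚ.≢-nonZero y≢0

÷'<÷'⇔ : ∀ {x y x' y'} → 0ℚ < y → 0ℚ < y' → x ÷' y < x' ÷' y' ⇔ x ℚ.* y' < x' ℚ.* y
÷'<÷'⇔ {x} {y} {x'} {y'} 0<y 0<y' = mk⇔
  (λ lt → subst₂ _<_ left right (ℚ.*-monoˡ-<-pos (y ℚ.* y') lt))
  (λ lt → ℚ.*-cancelʳ-<-nonNeg (y ℚ.* y') (subst₂ _<_ (sym left) (sym right) lt))
  where
  instance
    _ = ℚ.positive 0<y
    _ = ℚ.positive 0<y'
    _ = ℚ.pos*pos⇒pos y y'
    _ = ℚ.pos⇒nonNeg (y ℚ.* y')
  left : (x ÷' y) ℚ.* (y ℚ.* y') ≡ x ℚ.* y'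
  left = trans (sym (ℚ.*-assoc (x ÷' y) y y')) (cong (ℚ._* y') (÷'-*-cancel x 0<y))
  right : (x' ÷' y') ℚ.* (y ℚ.* y') ≡ x' ℚ.* y
  right = trans (cong ((x' ÷' y') ℚ.*_) (ℚ.*-comm y y'))
         (trans (sym (ℚ.*-assoc (x' ÷' y') y' y)) (cong (ℚ._* y) (÷'-*-cancel x' 0<y')))

percentileOf : ℕ → ℕ → ℕ → ℚ
percentileOf l m c = (ℕ→ℚ l ℚ.+ ½ ℚ.* ℕ→ℚ m ℚ.+ ½) ÷' ℕ→ℚ (suc c)

private
  ℕ→ℚ-suc>0 : ∀ k → 0ℚ < ℕ→ℚ (suc k)
  ℕ→ℚ-suc>0 k = from (ℕ→ℚ<ℕ→ℚ⇔< {0} {suc k}) (s≤s z≤n)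

  ℕ→ℚ-2*+ : ∀ a b → ℕ→ℚ (2 * a + b) ≡ ℕ→ℚ 2 ℚ.* ℕ→ℚ a ℚ.+ ℕ→ℚ b
  ℕ→ℚ-2*+ a b = trans (ℕ→ℚ-homo-+ (2 * a) b) (cong (ℚ._+ ℕ→ℚ b) (ℕ→ℚ-homo-* 2 a))

  l+½m+½≡½[2l+m+1] : ∀ l m → ℕ→ℚ l ℚ.+ ½ ℚ.* ℕ→ℚ m ℚ.+ ½ ≡ ½ ℚ.* ℕ→ℚ (2 * l + m + 1)
  l+½m+½≡½[2l+m+1] l m = begin
    ℕ→ℚ l ℚ.+ ½ ℚ.* ℕ→ℚ m ℚ.+ ½
      ≡⟨ solve 2 (λ l m → l :+ con ½ :* m :+ con ½ := con ½ :* (con (ℕ→ℚ 2) :* l :+ m :+ con 1ℚ))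
               refl (ℕ→ℚ l) (ℕ→ℚ m) ⟩
    ½ ℚ.* (ℕ→ℚ 2 ℚ.* ℕ→ℚ l ℚ.+ ℕ→ℚ m ℚ.+ 1ℚ)
      ≡⟨ cong (½ ℚ.*_) (trans (ℕ→ℚ-homo-+ (2 * l + m) 1) (cong (ℚ._+ 1ℚ) (ℕ→ℚ-2*+ l m))) ⟨
    ½ ℚ.* ℕ→ℚ (2 * l + m + 1) ∎
    where
    open ≡-Reasoning
    open +-*-Solver

  l+m+s-1≡k : ∀ l m s {k} → l + m + s ≡ suc k → ℕ→ℚ l ℚ.+ ℕ→ℚ m ℚ.+ ℕ→ℚ s ℚ.- 1ℚ ≡ ℕ→ℚ k
  l+m+s-1≡k l m s {k} l+m+s≡1+k = begin
    ℕ→ℚ l ℚ.+ ℕ→ℚ m ℚ.+ ℕ→ℚ s ℚ.- 1ℚ ≡⟨ cong (ℚ._- 1ℚ) ℕ→ℚ[l+m+s] ⟨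
    ℕ→ℚ (l + m + s) ℚ.- 1ℚ             ≡⟨ cong (λ n → ℕ→ℚ n ℚ.- 1ℚ) l+m+s≡1+k ⟩
    ℕ→ℚ (1 + k) ℚ.- 1ℚ                 ≡⟨ cong (ℚ._- 1ℚ) (ℕ→ℚ-homo-+ 1 k) ⟩
    1ℚ ℚ.+ ℕ→ℚ k ℚ.- 1ℚ                ≡⟨ solve 1 (λ k → con 1ℚ :+ k :- con 1ℚ := k) refl (ℕ→ℚ k) ⟩
    ℕ→ℚ k                              ∎
    where
    open ≡-Reasoning
    open +-*-Solver
    ℕ→ℚ[l+m+s] : ℕ→ℚ (l + m + s) ≡ ℕ→ℚ l ℚ.+ ℕ→ℚ m ℚ.+ ℕ→ℚ s
    ℕ→ℚ[l+m+s] = trans (ℕ→ℚ-homo-+ (l + m) s) (cong (ℚ._+ ℕ→ℚ s) (ℕ→ℚ-homo-+ l m))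

  [l+½m-1]c+c≡½[[2l+m]c] : ∀ l m c →
    (ℕ→ℚ l ℚ.+ ½ ℚ.* ℕ→ℚ m ℚ.- 1ℚ) ℚ.* ℕ→ℚ c ℚ.+ ℕ→ℚ c ≡ ½ ℚ.* ℕ→ℚ ((2 * l + m) * c)
  [l+½m-1]c+c≡½[[2l+m]c] l m c = begin
    (ℕ→ℚ l ℚ.+ ½ ℚ.* ℕ→ℚ m ℚ.- 1ℚ) ℚ.* ℕ→ℚ c ℚ.+ ℕ→ℚ c
      ≡⟨ solve 3 (λ l m c → (l :+ con ½ :* m :- con 1ℚ) :* c :+ c := con ½ :* ((con (ℕ→ℚ 2) :* l :+ m) :* c))
               refl (ℕ→ℚ l) (ℕ→ℚ m) (ℕ→ℚ c) ⟩
    ½ ℚ.* ((ℕ→ℚ 2 ℚ.* ℕ→ℚ l ℚ.+ ℕ→ℚ m) ℚ.* ℕ→ℚ c)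
      ≡⟨ cong (½ ℚ.*_) (trans (ℕ→ℚ-homo-* (2 * l + m) c) (cong (ℚ._* ℕ→ℚ c) (ℕ→ℚ-2*+ l m))) ⟨
    ½ ℚ.* ℕ→ℚ ((2 * l + m) * c) ∎
    where
    open ≡-Reasoning
    open +-*-Solver

  ½ab+c≡½[ab+2c] : ∀ a b c → ½ ℚ.* ℕ→ℚ a ℚ.* ℕ→ℚ b ℚ.+ ℕ→ℚ c ≡ ½ ℚ.* ℕ→ℚ (a * b + 2 * c)
  ½ab+c≡½[ab+2c] a b c = begin
    ½ ℚ.* ℕ→ℚ a ℚ.* ℕ→ℚ b ℚ.+ ℕ→ℚ c
      ≡⟨ solve 3 (λ a b c → con ½ :* a :* b :+ c := con ½ :* (a :* b :+ con (ℕ→ℚ 2) :* c))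
               refl (ℕ→ℚ a) (ℕ→ℚ b) (ℕ→ℚ c) ⟩
    ½ ℚ.* (ℕ→ℚ a ℚ.* ℕ→ℚ b ℚ.+ ℕ→ℚ 2 ℚ.* ℕ→ℚ c)
      ≡⟨ cong (½ ℚ.*_) (trans (ℕ→ℚ-homo-+ (a * b) (2 * c))
                              (cong₂ ℚ._+_ (ℕ→ℚ-homo-* a b) (ℕ→ℚ-homo-* 2 c))) ⟨
    ½ ℚ.* ℕ→ℚ (a * b + 2 * c) ∎
    where
    open ≡-Reasoning
    open +-*-Solver

  scaled-percentile-numerator : ∀ l m c l' m' s' k → l' + m' + s' ≡ suc (suc k) →
    (ℕ→ℚ l ℚ.+ ½ ℚ.* ℕ→ℚ m ℚ.+ ½) ℚ.* (ℕ→ℚ l' ℚ.+ ℕ→ℚ m' ℚ.+ ℕ→ℚ s' ℚ.- 1ℚ) ℚ.+ ℕ→ℚ (suc c)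
      ≡ ½ ℚ.* ℕ→ℚ ((2 * l + m + 1) * suc k + 2 * suc c)
  scaled-percentile-numerator l m c l' m' s' k size≡2+k = begin
    (ℕ→ℚ l ℚ.+ ½ ℚ.* ℕ→ℚ m ℚ.+ ½) ℚ.* _ ℚ.+ ℕ→ℚ (suc c)
      ≡⟨ cong₂ (λ x y → x ℚ.* y ℚ.+ ℕ→ℚ (suc c)) (l+½m+½≡½[2l+m+1] l m) (l+m+s-1≡k l' m' s' size≡2+k) ⟩
    ½ ℚ.* ℕ→ℚ (2 * l + m + 1) ℚ.* ℕ→ℚ (suc k) ℚ.+ ℕ→ℚ (suc c)
      ≡⟨ ½ab+c≡½[ab+2c] (2 * l + m + 1) (suc k) (suc c) ⟩
    ½ ℚ.* ℕ→ℚ ((2 * l + m + 1) * suc k + 2 * suc c) ∎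
    where open ≡-Reasoning

percentileOf<percentileOf⇔ : ∀ l m c l' m' c' →
  percentileOf l m c < percentileOf l' m' c' ⇔ (2 * l + m + 1) * suc c' ℕ.< (2 * l' + m' + 1) * suc c
percentileOf<percentileOf⇔ l m c l' m' c' =
  ÷'<÷'⇔ (ℕ→ℚ-suc>0 c) (ℕ→ℚ-suc>0 c') ⟨⇔⟩ <⇔<-halves (scaled l m c') (scaled l' m' c)
  where
  scaled : ∀ l m c →
    (ℕ→ℚ l ℚ.+ ½ ℚ.* ℕ→ℚ m ℚ.+ ½) ℚ.* ℕ→ℚ (suc c) ℚ.+ 0ℚ ≡ ½ ℚ.* ℕ→ℚ ((2 * l + m + 1) * suc c)
  scaled l m c = begin
    (ℕ→ℚ l ℚ.+ ½ ℚ.* ℕ→ℚ m ℚ.+ ½) ℚ.* ℕ→ℚ (suc c) ℚ.+ 0ℚ ≡⟨ ℚ.+-identityʳ _ ⟩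
    (ℕ→ℚ l ℚ.+ ½ ℚ.* ℕ→ℚ m ℚ.+ ½) ℚ.* ℕ→ℚ (suc c)        ≡⟨ cong (ℚ._* ℕ→ℚ (suc c)) (l+½m+½≡½[2l+m+1] l m) ⟩
    ½ ℚ.* ℕ→ℚ A ℚ.* ℕ→ℚ (suc c)                          ≡⟨ ℚ.*-assoc ½ (ℕ→ℚ A) (ℕ→ℚ (suc c)) ⟩
    ½ ℚ.* (ℕ→ℚ A ℚ.* ℕ→ℚ (suc c))                        ≡⟨ cong (½ ℚ.*_) (ℕ→ℚ-homo-* A (suc c)) ⟨
    ½ ℚ.* ℕ→ℚ (A * suc c)                                ∎
    where
    open ≡-Reasoning
    A : ℕ
    A = 2 * l + m + 1

percentileOf<mergeRatio⇔ : ∀ l m c l' m' s' k → l' + m' + s' ≡ suc (suc k) →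
  percentileOf l m c < mergeRatio l' m' s' ⇔ (2 * l + m + 1) * suc k + 2 * suc c ℕ.< (2 * l' + m') * suc c
percentileOf<mergeRatio⇔ l m c l' m' s' k size≡2+k =
  ÷'<÷'⇔ (ℕ→ℚ-suc>0 c) (subst (0ℚ <_) (sym (l+m+s-1≡k l' m' s' size≡2+k)) (ℕ→ℚ-suc>0 k))
  ⟨⇔⟩ <⇔<-halves (scaled-percentile-numerator l m c l' m' s' k size≡2+k) ([l+½m-1]c+c≡½[[2l+m]c] l' m' (suc c))

mergeRatio<percentileOf⇔ : ∀ l m c l' m' s' k → l' + m' + s' ≡ suc (suc k) →
  mergeRatio l' m' s' < percentileOf l m c ⇔ (2 * l' + m') * suc c ℕ.< (2 * l + m + 1) * suc k + 2 * suc c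
mergeRatio<percentileOf⇔ l m c l' m' s' k size≡2+k =
  ÷'<÷'⇔ (subst (0ℚ <_) (sym (l+m+s-1≡k l' m' s' size≡2+k)) (ℕ→ℚ-suc>0 k)) (ℕ→ℚ-suc>0 c)
  ⟨⇔⟩ <⇔<-halves ([l+½m-1]c+c≡½[[2l+m]c] l' m' (suc c)) (scaled-percentile-numerator l m c l' m' s' k size≡2+k)

<-offset⇔ : ∀ {x y} z {u v} → u + z ≡ x → v + z ≡ y → x ℕ.< y ⇔ u ℕ.< v
<-offset⇔ {x} {y} z {u} {v} u+z≡x v+z≡y = mk⇔
  (λ x<y → ℕ.+-cancelʳ-< z u v (subst₂ ℕ._<_ (sym u+z≡x) (sym v+z≡y) x<y))
  (λ u<v → subst₂ ℕ._<_ u+z≡x v+z≡y (ℕ.+-monoˡ-< z u<v))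

-- The cross-multiplied comparison of two percentiles, rearranged into the sums over fibres
-- of coarseTerm and fineTerm in Percentiles.Coarsening.
module _ (sP cP sQ cQ : ℕ) where

  private
    offset : ℕ
    offset = sP + 1 + suc cP
    coarse≡ : (sQ + 1) * suc cP + (sP + 1) * suc cP ≡ (sP + 1) * cP + suc cP * sQ + offset
    coarse≡ = solve 3 (λ sP cP sQ → (sQ :+ con 1) :* (con 1 :+ cP) :+ (sP :+ con 1) :* (con 1 :+ cP)
                       := (sP :+ con 1) :* cP :+ (con 1 :+ cP) :* sQ :+ (sP :+ con 1 :+ (con 1 :+ cP))) refl sP cP sQ
      where open ℕ-Solver
    fine≡ : (sP + 1) * suc cQ + (sP + 1) * suc cP ≡ (sP + 1) * cQ + suc cP * sP + offset
    fine≡ = solve 3 (λ sP cP cQ → (sP :+ con 1) :* (con 1 :+ cQ) :+ (sP :+ con 1) :* (con 1 :+ cP)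
                     := (sP :+ con 1) :* cQ :+ (con 1 :+ cP) :* sP :+ (sP :+ con 1 :+ (con 1 :+ cP))) refl sP cP cQ
      where open ℕ-Solver

  cross-<⇔ : (sQ + 1) * suc cP ℕ.< (sP + 1) * suc cQ ⇔ (sP + 1) * cP + suc cP * sQ ℕ.< (sP + 1) * cQ + suc cP * sP
  cross-<⇔ = ⇔-sym (<-offset⇔ ((sP + 1) * suc cP) coarse≡ fine≡) ⟨⇔⟩ <-offset⇔ offset refl refl

  cross->⇔ : (sP + 1) * suc cQ ℕ.< (sQ + 1) * suc cP ⇔ (sP + 1) * cQ + suc cP * sP ℕ.< (sP + 1) * cP + suc cP * sQ
  cross->⇔ = ⇔-sym (<-offset⇔ ((sP + 1) * suc cP) fine≡ coarse≡) ⟨⇔⟩ <-offset⇔ offset refl refl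

-- A fibre's coarseTerm against its fineTerm, for a fibre of k + 2 parts.
module _ (a b k : ℕ) where

  private
    merged-large : a * suc k + 2 * b + a ≡ a * suc (suc k) + b * 2
    merged-large = solve 3 (λ a b k → a :* (con 1 :+ k) :+ con 2 :* b :+ a := a :* (con 2 :+ k) :+ b :* con 2) refl a b k
      where open ℕ-Solver
    parts-weight : ∀ W → W * b + a ≡ a + b * W
    parts-weight W = trans (ℕ.+-comm (W * b) a) (cong (a +_) (ℕ.*-comm W b))
    a+b*0≡a : a + b * 0 ≡ a
    a+b*0≡a = trans (cong (a +_) (ℕ.*-zeroʳ b)) (ℕ.+-identityʳ a)

  plural-fibre-<⇔ : ∀ {w' W} → w' ≡ 2 ⊎ W ≡ 0 →
                    a * suc (suc k) + b * w' ℕ.< a + b * W ⇔ a * suc k + 2 * b ℕ.< W * b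
  plural-fibre-<⇔ {W = W} (inj₁ refl) = <-offset⇔ a merged-large (parts-weight W)
  plural-fibre-<⇔ {w'} (inj₂ refl) = mk⇔
    (λ lt → ⊥-elim (ℕ.<⇒≱ lt (ℕ.≤-trans (ℕ.≤-reflexive a+b*0≡a)
                              (ℕ.≤-trans (ℕ.m≤m*n a (suc (suc k))) (ℕ.m≤m+n _ (b * w'))))))
    (λ ())

  plural-fibre->⇔ : ∀ {w' W} → 1 ≤ a → w' ≡ 2 ⊎ W ≡ 0 →
                    a + b * W ℕ.< a * suc (suc k) + b * w' ⇔ W * b ℕ.< a * suc k + 2 * b
  plural-fibre->⇔ {W = W} _ (inj₁ refl) = <-offset⇔ a (parts-weight W) merged-large
  plural-fibre->⇔ {w'} 1≤a (inj₂ refl) = mk⇔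
    (λ _ → ℕ.≤-trans 1≤a (ℕ.≤-trans (ℕ.m≤m*n a (suc k)) (ℕ.m≤m+n _ (2 * b))))
    (λ _ → subst (ℕ._< a * suc (suc k) + b * w') (sym a+b*0≡a)
                 (ℕ.<-≤-trans (ℕ.m<m*n a _ (s≤s (s≤s z≤n))) (ℕ.m≤m+n _ (b * w'))))
    where instance _ = ℕ.>-nonZero 1≤a

2≤⇒≡2+ : ∀ {x} → 2 ≤ x → ∃ λ k → x ≡ suc (suc k)
2≤⇒≡2+ (s≤s (s≤s {n = k} _)) = k , refl

𝟙 : ∀ {a} {A : Set a} → Dec A → ℕ
𝟙 a? = if does a? then 1 else 0

module _ {a} {A : Set a} where

  𝟙-yes : (a? : Dec A) → A → 𝟙 a? ≡ 1
  𝟙-yes a? x = cong (λ t → if t then 1 else 0) (dec-true a? x)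

  𝟙-no : (a? : Dec A) → ¬ A → 𝟙 a? ≡ 0
  𝟙-no a? ¬x = cong (λ t → if t then 1 else 0) (dec-false a? ¬x)

module _ {a b} {A : Set a} {B : Set b} where

  𝟙-×-dec : (a? : Dec A) (b? : Dec B) → 𝟙 (a? ×-dec b?) ≡ 𝟙 a? * 𝟙 b?
  𝟙-×-dec (yes _) (yes _) = refl
  𝟙-×-dec (yes _) (no _)  = refl
  𝟙-×-dec (no _)  _       = refl

length-filter-tabulate : ∀ {a p} {A : Set a} {P : Pred A p} (P? : Decidable P) {n} (f : Fin n → A) →
                         length (filter P? (List.tabulate f)) ≡ ∑[ i < n ] 𝟙 (P? (f i))
length-filter-tabulate P? {zero}  f = refl
length-filter-tabulate P? {suc n} f with P? (f zero)
... | yes _ = cong suc (length-filter-tabulate P? (f ∘ suc))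
... | no _  = length-filter-tabulate P? (f ∘ suc)

count-∈-×-dec : ∀ {p} {P : Pred (Fin k) p} (T : Subset k) (P? : Decidable P) →
                length (filter (λ i → (i ∈? T) ×-dec P? i) (List.allFin k)) ≡ ∑[ i < k ] (𝟙 (i ∈? T) * 𝟙 (P? i))
count-∈-×-dec T P? = trans (length-filter-tabulate (λ i → (i ∈? T) ×-dec P? i) (λ i → i))
                           (sum-cong-≗ (λ i → 𝟙-×-dec (i ∈? T) (P? i)))

∑-const : ∀ n x → ∑[ i < n ] x ≡ n * x
∑-const zero    x = refl
∑-const (suc n) x = cong (x +_) (∑-const n x)

∑-mono-≤ : ∀ {n} {f g : Vector ℕ n} → (∀ i → f i ≤ g i) → sum f ≤ sum g
∑-mono-≤ {zero}  f≤g = z≤n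
∑-mono-≤ {suc n} f≤g = ℕ.+-mono-≤ (f≤g zero) (∑-mono-≤ (f≤g ∘ suc))

∑<∑⇒∃< : ∀ {n} (f g : Vector ℕ n) → sum f ℕ.< sum g → ∃ λ i → f i ℕ.< g i
∑<∑⇒∃< f g ∑f<∑g with any? (λ i → f i ℕ.<? g i)
... | yes f<g = f<g
... | no ¬f<g = ⊥-elim (ℕ.<⇒≱ ∑f<∑g (∑-mono-≤ (λ i → ℕ.≮⇒≥ (λ f<g → ¬f<g (i , f<g)))))

term≤∑ : ∀ {n} (f : Vector ℕ n) i → f i ≤ sum f
term≤∑ {suc n} f i = ℕ.≤-trans (ℕ.m≤m+n (f i) _) (ℕ.≤-reflexive (sym (sum-remove f)))

pair≤∑ : ∀ {n} (f : Vector ℕ n) {i j} → i ≢ j → f i + f j ≤ sum f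
pair≤∑ {suc n} f {i} {j} i≢j = begin
  f i + f j                                   ≡⟨ cong (λ k → f i + f k) (punchIn-punchOut i≢j) ⟨
  f i + removeAt f i (punchOut i≢j)           ≤⟨ ℕ.+-monoʳ-≤ (f i) (term≤∑ (removeAt f i) (punchOut i≢j)) ⟩
  f i + sum (removeAt f i)                    ≡⟨ sum-remove f ⟨
  sum f                                       ∎
  where open ℕ.≤-Reasoning

∑-single : ∀ {n} (f : Vector ℕ n) i → (∀ j → j ≢ i → f j ≡ 0) → sum f ≡ f i
∑-single {suc n} f i zero-elsewhere = begin
  sum f                     ≡⟨ sum-remove f ⟩
  f i + sum (removeAt f i)  ≡⟨ cong (f i +_) (sum-cong-≗ (λ k → zero-elsewhere (punchIn i k) (punchInᵢ≢i i k))) ⟩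
  f i + sum {n} (λ _ → 0)   ≡⟨ cong (f i +_) (sum-replicate-zero n) ⟩
  f i + 0                   ≡⟨ ℕ.+-identityʳ (f i) ⟩
  f i                       ∎
  where open ≡-Reasoning

module _ {a} {A : Set a} where

  foldr-+-map-mono-≤ : ∀ {f g : A → ℚ} → (∀ x → f x ℚ.≤ g x) → ∀ xs →
                       foldr ℚ._+_ 0ℚ (List.map f xs) ℚ.≤ foldr ℚ._+_ 0ℚ (List.map g xs)
  foldr-+-map-mono-≤ f≤g []       = ℚ.≤-refl
  foldr-+-map-mono-≤ f≤g (x ∷ xs) = ℚ.+-mono-≤ (f≤g x) (foldr-+-map-mono-≤ f≤g xs)

  foldr-+-map-mono-< : ∀ {f g : A → ℚ} → (∀ x → f x ℚ.≤ g x) → ∀ {x xs} → x ∈ₗ xs → f x < g x →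
                       foldr ℚ._+_ 0ℚ (List.map f xs) < foldr ℚ._+_ 0ℚ (List.map g xs)
  foldr-+-map-mono-< f≤g {xs = _ ∷ xs} (here refl) fx<gx = ℚ.+-mono-<-≤ fx<gx (foldr-+-map-mono-≤ f≤g xs)
  foldr-+-map-mono-< f≤g {xs = y ∷ _} (there x∈xs) fx<gx = ℚ.+-mono-≤-< (f≤g y) (foldr-+-map-mono-< f≤g x∈xs fx<gx)

measure-mono-< : ∀ {μ : Fin n → ℚ} → (∀ v → 0ℚ < μ v) → ∀ {S S' v} → S ⊆ S' → v ∈ S' → v ∉ S →
                 measure μ S < measure μ S'
measure-mono-< {n = n} {μ} μ>0 {S} {S'} {v} S⊆S' v∈S' v∉S =
  foldr-+-map-mono-< term-mono (∈-allFin v) (term-strict (v ∈? S) (v ∈? S'))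
  where
  term : Subset n → Fin n → ℚ
  term T u = if ⌊ u ∈? T ⌋ then μ u else 0ℚ
  term-mono : ∀ u → term S u ℚ.≤ term S' u
  term-mono u with u ∈? S | u ∈? S'
  ... | yes _    | yes _    = ℚ.≤-refl
  ... | yes u∈S  | no u∉S'  = ⊥-elim (u∉S' (S⊆S' u∈S))
  ... | no _     | yes _    = ℚ.<⇒≤ (μ>0 u)
  ... | no _     | no _     = ℚ.≤-refl
  term-strict : (v∈S? : Dec (v ∈ S)) (v∈S'? : Dec (v ∈ S')) →
                (if ⌊ v∈S? ⌋ then μ v else 0ℚ) < (if ⌊ v∈S'? ⌋ then μ v else 0ℚ)
  term-strict (yes v∈S) _          = ⊥-elim (v∉S v∈S)
  term-strict (no _)    (yes _)    = μ>0 v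
  term-strict (no _)    (no v∉S')  = ⊥-elim (v∉S' v∈S')

fibre : (Fin k → Fin m) → Fin m → Subset k
fibre g j = Vec.tabulate (λ i → ⌊ g i Fin.≟ j ⌋)

⌊⌋≡true⇔ : ∀ {b} {B : Set b} (b? : Dec B) → ⌊ b? ⌋ ≡ true ⇔ B
⌊⌋≡true⇔ (yes b) = mk⇔ (λ _ → b) (λ _ → refl)
⌊⌋≡true⇔ (no ¬b) = mk⇔ (λ ()) (λ b → ⊥-elim (¬b b))

∈-tabulate⇔ : ∀ {g : Fin n → Bool} {v} → v ∈ Vec.tabulate g ⇔ g v ≡ true
∈-tabulate⇔ {g = g} {v} = mk⇔
  (λ v∈ → trans (sym (Vec.lookup∘tabulate g v)) (Vec.[]=⇒lookup v∈))
  (λ gv≡true → Vec.lookup⇒[]= v _ (trans (Vec.lookup∘tabulate g v) gv≡true))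

∈-tabulate-dec⇔ : ∀ {p} {P : Pred (Fin n) p} {P? : Decidable P} {v} → v ∈ Vec.tabulate (λ v → ⌊ P? v ⌋) ⇔ P v
∈-tabulate-dec⇔ {P? = P?} {v} = ∈-tabulate⇔ ⟨⇔⟩ ⌊⌋≡true⇔ (P? v)

∈-fibre⇔ : ∀ {g : Fin k → Fin m} {j i} → i ∈ fibre g j ⇔ g i ≡ j
∈-fibre⇔ = ∈-tabulate-dec⇔

𝟙-∈-fibre : ∀ {g : Fin k → Fin m} {i j} → g i ≡ j → 𝟙 (i ∈? fibre g j) ≡ 1
𝟙-∈-fibre {g = g} {i} {j} gi≡j = 𝟙-yes (i ∈? fibre g j) (from ∈-fibre⇔ gi≡j)

𝟙-∉-fibre : ∀ {g : Fin k → Fin m} {i j} → g i ≢ j → 𝟙 (i ∈? fibre g j) ≡ 0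
𝟙-∉-fibre {g = g} {i} {j} gi≢j = 𝟙-no (i ∈? fibre g j) (gi≢j ∘ to ∈-fibre⇔)

≡-from-∈⇔ : ∀ {S S' : Subset n} → (∀ {v} → v ∈ S ⇔ v ∈ S') → S ≡ S'
≡-from-∈⇔ S⇔S' = ⊆-antisym (to S⇔S') (from S⇔S')

∈-partOf⇔ : ∀ (lab : Fin n → Maybe (Fin k)) {i v} → v ∈ partOf lab i ⇔ lab v ≡ just i
∈-partOf⇔ lab = ∈-tabulate-dec⇔

∈-unionOf⇔ : ∀ (lab : Fin n → Maybe (Fin k)) {T v} → v ∈ unionOf lab T ⇔ ∃ λ i → lab v ≡ just i × i ∈ T
∈-unionOf⇔ lab {T} {v} = mk⇔ into out-of
  where
  into : v ∈ unionOf lab T → ∃ λ i → lab v ≡ just i × i ∈ T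
  into v∈ with lab v | to ∈-tabulate⇔ v∈
  ... | just i | i∈T = i , refl , to (⌊⌋≡true⇔ (i ∈? T)) i∈T
  out-of : (∃ λ i → lab v ≡ just i × i ∈ T) → v ∈ unionOf lab T
  out-of (i , labv≡i , i∈T) with Vec.lookup (unionOf lab T) v in e
  ... | true  = Vec.lookup⇒[]= v _ e
  ... | false with lab v | labv≡i | trans (sym (Vec.lookup∘tabulate _ v)) e
  ...   | just i | refl | ⌊i∈T⌋≡false with () ← trans (sym (from (⌊⌋≡true⇔ (i ∈? T)) i∈T)) ⌊i∈T⌋≡false

partOf-map≡unionOf-fibre : ∀ (lab : Fin n → Maybe (Fin k)) (g : Fin k → Fin m) j →
                           partOf (Maybe.map g ∘ lab) j ≡ unionOf lab (fibre g j)
partOf-map≡unionOf-fibre lab g j = ≡-from-∈⇔ (λ {v} →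
  ∈-partOf⇔ (Maybe.map g ∘ lab) ⟨⇔⟩ map≡just⇔ (lab v) ⟨⇔⟩ ⇔-sym (∈-unionOf⇔ lab ⟨⇔⟩ in-fibre⇔))
  where
  map≡just⇔ : ∀ x → Maybe.map g x ≡ just j ⇔ ∃ λ i → x ≡ just i × g i ≡ j
  map≡just⇔ (just i) = mk⇔ (λ { refl → i , refl , refl }) (λ { (_ , refl , refl) → refl })
  map≡just⇔ nothing  = mk⇔ (λ ()) (λ { (_ , () , _) })
  in-fibre⇔ : ∀ {x} → (∃ λ i → x ≡ just i × i ∈ fibre g j) ⇔ (∃ λ i → x ≡ just i × g i ≡ j)
  in-fibre⇔ = mk⇔ (λ { (i , x≡i , i∈) → i , x≡i , to ∈-fibre⇔ i∈ })
                  (λ { (i , x≡i , gi≡j) → i , x≡i , from ∈-fibre⇔ gi≡j })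

unionOf-singleton : ∀ (lab : Fin n → Maybe (Fin k)) {T i} → (∀ {i'} → i' ∈ T ⇔ i' ≡ i) →
                    unionOf lab T ≡ partOf lab i
unionOf-singleton lab {T} {i} T≡⁅i⁆ = ≡-from-∈⇔ (∈-unionOf⇔ lab ⟨⇔⟩ only-i ⟨⇔⟩ ⇔-sym (∈-partOf⇔ lab))
  where
  only-i : ∀ {x} → (∃ λ i' → x ≡ just i' × i' ∈ T) ⇔ x ≡ just i
  only-i = mk⇔ (λ { (i' , x≡i' , i'∈T) → trans x≡i' (cong just (to T≡⁅i⁆ i'∈T)) })
               (λ x≡i → i , x≡i , from T≡⁅i⁆ refl)

-- Merging a set of parts

merge : (T : Subset k) → Fin k → Fin (suc ∣ ∁ T ∣)
merge (inside  ∷ T) zero    = zero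
merge (inside  ∷ T) (suc i) = merge T i
merge (outside ∷ T) zero    = suc zero
merge (outside ∷ T) (suc i) = punchIn (suc zero) (merge T i)

merge≡0⇔∈ : ∀ (T : Subset k) {i} → merge T i ≡ zero ⇔ i ∈ T
merge≡0⇔∈ (inside  ∷ T) {zero}  = mk⇔ (λ _ → here) (λ _ → refl)
merge≡0⇔∈ (inside  ∷ T) {suc i} = merge≡0⇔∈ T ⟨⇔⟩ mk⇔ there drop-there
merge≡0⇔∈ (outside ∷ T) {zero}  = mk⇔ (λ ()) (λ ())
merge≡0⇔∈ (outside ∷ T) {suc i} = punchIn₁≡0⇔ ⟨⇔⟩ merge≡0⇔∈ T ⟨⇔⟩ mk⇔ there drop-there
  where
  punchIn₁≡0⇔ : ∀ {m} {r : Fin (suc m)} → punchIn (suc zero) r ≡ zero ⇔ r ≡ zero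
  punchIn₁≡0⇔ {r = zero}  = mk⇔ (λ _ → refl) (λ _ → refl)
  punchIn₁≡0⇔ {r = suc r} = mk⇔ (λ ()) (λ ())

merge-injective : ∀ (T : Subset k) {i i'} → i ∉ T → merge T i ≡ merge T i' → i ≡ i'
merge-injective (inside  ∷ T) {zero}           i∉T _ = ⊥-elim (i∉T here)
merge-injective (inside  ∷ T) {suc i} {zero}   i∉T eq = ⊥-elim (i∉T (there (to (merge≡0⇔∈ T) eq)))
merge-injective (inside  ∷ T) {suc i} {suc i'} i∉T eq = cong suc (merge-injective T (i∉T ∘ there) eq)
merge-injective (outside ∷ T) {zero}  {zero}   _   _  = refl
merge-injective (outside ∷ T) {zero}  {suc i'} _   eq = ⊥-elim (punchInᵢ≢i (suc zero) (merge T i') (sym eq))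
merge-injective (outside ∷ T) {suc i} {zero}   _   eq = ⊥-elim (punchInᵢ≢i (suc zero) (merge T i) eq)
merge-injective (outside ∷ T) {suc i} {suc i'} i∉T eq =
  cong suc (merge-injective T (i∉T ∘ there) (punchIn-injective (suc zero) (merge T i) (merge T i') eq))

merge-surjective : ∀ (T : Subset k) r → ∃ λ i → merge T i ≡ suc r
merge-surjective (inside  ∷ T) r       = let i , eq = merge-surjective T r in suc i , eq
merge-surjective (outside ∷ T) zero    = zero , refl
merge-surjective (outside ∷ T) (suc r) = let i , eq = merge-surjective T r in suc i , cong (punchIn (suc zero)) eq

module _ {E : Fin n → Fin n → Set} {S* : Subset n} (P : ValidPartition E S*) (T : Subset (c P)) where

  merge-fibre-suc : ∀ r → ∃ λ i → ∀ {i'} → i' ∈ fibre (merge T) (suc r) ⇔ i' ≡ i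
  merge-fibre-suc r = i , ∈-fibre⇔ ⟨⇔⟩ mk⇔ (λ eq → sym (merge-injective T i∉T (trans mi≡r (sym eq))))
                                           (λ { refl → mi≡r })
    where
    i : Fin (c P)
    i = proj₁ (merge-surjective T r)
    mi≡r : merge T i ≡ suc r
    mi≡r = proj₂ (merge-surjective T r)
    i∉T : i ∉ T
    i∉T i∈T with () ← trans (sym mi≡r) (from (merge≡0⇔∈ T) i∈T)

  merge-fibre-zero : fibre (merge T) zero ≡ T
  merge-fibre-zero = ≡-from-∈⇔ (∈-fibre⇔ ⟨⇔⟩ merge≡0⇔∈ T)

  merged : Connected E (union P T) → ValidPartition E S*
  merged conn = record
    { c         = suc ∣ ∁ T ∣
    ; lab       = Maybe.map (merge T) ∘ lab P
    ; lab-S*    = λ v → lab-S* P v ⟨⇔⟩ map≡nothing⇔ (lab P v)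
    ; part-conn = λ j → subst (Connected E) (sym (partOf-map≡unionOf-fibre (lab P) (merge T) j)) (fibre-connected j)
    }
    where
    map≡nothing⇔ : ∀ x → x ≡ nothing ⇔ Maybe.map (merge T) x ≡ nothing
    map≡nothing⇔ nothing  = mk⇔ (λ _ → refl) (λ _ → refl)
    map≡nothing⇔ (just _) = mk⇔ (λ ()) (λ ())
    fibre-connected : ∀ j → Connected E (union P (fibre (merge T) j))
    fibre-connected zero    = subst (λ T' → Connected E (union P T')) (sym merge-fibre-zero) conn
    fibre-connected (suc r) = subst (Connected E) (sym (unionOf-singleton (lab P) (proj₂ (merge-fibre-suc r))))
                                    (part-conn P (proj₁ (merge-fibre-suc r)))

  merged-coarser : ∀ conn i → part P i ⊆ part (merged conn) (merge T i)
  merged-coarser conn i v∈Pi = from (∈-partOf⇔ (lab (merged conn)))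
                                 (cong (Maybe.map (merge T)) (to (∈-partOf⇔ (lab P)) v∈Pi))

-- Weights, fibres and coarsenings

module Percentiles {n} {E : Fin n → Fin n → Set} {S* : Subset n} (μ : Fin n → ℚ) where

  private
    μ* : ℚ
    μ* = measure μ S*

  weight : Subset n → ℕ
  weight S = 2 * 𝟙 (μ* ℚ.<? measure μ S) + 𝟙 (measure μ S ℚ.≟ μ*)

  weight-large : ∀ {S} → μ* < measure μ S → weight S ≡ 2
  weight-large {S} μ*<μS = cong₂ (λ l m → 2 * l + m) (𝟙-yes (μ* ℚ.<? measure μ S) μ*<μS)
                                                      (𝟙-no (measure μ S ℚ.≟ μ*) (ℚ.<⇒≢ μ*<μS ∘ sym))

  weight-small : ∀ {S} → measure μ S < μ* → weight S ≡ 0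
  weight-small {S} μS<μ* = cong₂ (λ l m → 2 * l + m) (𝟙-no (μ* ℚ.<? measure μ S) (ℚ.<-asym μS<μ*))
                                                      (𝟙-no (measure μ S ℚ.≟ μ*) (ℚ.<⇒≢ μS<μ*))

  large+medium+small≡1 : ∀ x → 𝟙 (μ* ℚ.<? x) + 𝟙 (x ℚ.≟ μ*) + 𝟙 (x ℚ.<? μ*) ≡ 1
  large+medium+small≡1 x with ℚ.<-cmp x μ*
  ... | tri< x<μ* x≢μ* _
    rewrite 𝟙-no (μ* ℚ.<? x) (ℚ.<-asym x<μ*) | 𝟙-no (x ℚ.≟ μ*) x≢μ* | 𝟙-yes (x ℚ.<? μ*) x<μ* = refl
  ... | tri≈ _ x≡μ* _
    rewrite 𝟙-no (μ* ℚ.<? x) (ℚ.<-irrefl (sym x≡μ*)) | 𝟙-yes (x ℚ.≟ μ*) x≡μ*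
          | 𝟙-no (x ℚ.<? μ*) (ℚ.<-irrefl x≡μ*) = refl
  ... | tri> _ x≢μ* μ*<x
    rewrite 𝟙-yes (μ* ℚ.<? x) μ*<x | 𝟙-no (x ℚ.≟ μ*) x≢μ* | 𝟙-no (x ℚ.<? μ*) (ℚ.<-asym μ*<x) = refl

  partsIn : (P : ValidPartition E S*) → Subset (c P) → ℕ
  partsIn P T = nLarge μ P T + nMedium μ P T + nSmall μ P T

  mergeRatioOf : (P : ValidPartition E S*) → Subset (c P) → ℚ
  mergeRatioOf P T = mergeRatio (nLarge μ P T) (nMedium μ P T) (nSmall μ P T)

  score : (P : ValidPartition E S*) → Subset (c P) → ℕ
  score P T = ∑[ i < c P ] (𝟙 (i ∈? T) * weight (part P i))

  totalScore : ValidPartition E S* → ℕ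
  totalScore P = ∑[ i < c P ] weight (part P i)

  module _ (P : ValidPartition E S*) (T : Subset (c P)) where

    private
      μP : Fin (c P) → ℚ
      μP i = measure μ (part P i)
      inT large medium small : Fin (c P) → ℕ
      inT i = 𝟙 (i ∈? T)
      large i = 𝟙 (μ* ℚ.<? μP i)
      medium i = 𝟙 (μP i ℚ.≟ μ*)
      small i = 𝟙 (μP i ℚ.<? μ*)

    partsIn≡∑ : partsIn P T ≡ ∑[ i < c P ] 𝟙 (i ∈? T)
    partsIn≡∑ = begin
      partsIn P T
        ≡⟨ cong₂ _+_ (cong₂ _+_ (count-∈-×-dec T _) (count-∈-×-dec T _)) (count-∈-×-dec T _) ⟩
      ∑[ i < c P ] (inT i * large i) + ∑[ i < c P ] (inT i * medium i) + ∑[ i < c P ] (inT i * small i)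
        ≡⟨ trans (∑-distrib-+ (λ i → inT i * large i + inT i * medium i) (λ i → inT i * small i))
                 (cong (_+ ∑[ i < c P ] (inT i * small i)) (∑-distrib-+ (λ i → inT i * large i) (λ i → inT i * medium i))) ⟨
      ∑[ i < c P ] (inT i * large i + inT i * medium i + inT i * small i)
        ≡⟨ sum-cong-≗ (λ i → trans (factor (inT i) (large i) (medium i) (small i))
                                   (cong (inT i *_) (large+medium+small≡1 (μP i)))) ⟩
      ∑[ i < c P ] (inT i * 1)
        ≡⟨ sum-cong-≗ (λ i → ℕ.*-identityʳ (inT i)) ⟩
      ∑[ i < c P ] inT i ∎
      where
      open ≡-Reasoning
      factor : ∀ t l m s → t * l + t * m + t * s ≡ t * (l + m + s)
      factor = solve 4 (λ t l m s → t :* l :+ t :* m :+ t :* s := t :* (l :+ m :+ s)) refl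
        where open ℕ-Solver

    2*nLarge+nMedium≡score : 2 * nLarge μ P T + nMedium μ P T ≡ score P T
    2*nLarge+nMedium≡score = begin
      2 * nLarge μ P T + nMedium μ P T
        ≡⟨ cong₂ (λ x y → 2 * x + y) (count-∈-×-dec T _) (count-∈-×-dec T _) ⟩
      2 * ∑[ i < c P ] (inT i * large i) + ∑[ i < c P ] (inT i * medium i)
        ≡⟨ cong (_+ ∑[ i < c P ] (inT i * medium i)) (*-distribˡ-sum 2 (λ i → inT i * large i)) ⟩
      ∑[ i < c P ] (2 * (inT i * large i)) + ∑[ i < c P ] (inT i * medium i)
        ≡⟨ ∑-distrib-+ (λ i → 2 * (inT i * large i)) (λ i → inT i * medium i) ⟨
      ∑[ i < c P ] (2 * (inT i * large i) + inT i * medium i)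
        ≡⟨ sum-cong-≗ (λ i → factor (inT i) (large i) (medium i)) ⟩
      score P T ∎
      where
      open ≡-Reasoning
      factor : ∀ t l m → 2 * (t * l) + t * m ≡ t * (2 * l + m)
      factor = solve 3 (λ t l m → con 2 :* (t :* l) :+ t :* m := t :* (con 2 :* l :+ m)) refl
        where open ℕ-Solver

  2*nLarge+nMedium≡totalScore : ∀ P → 2 * nLarge μ P (allParts μ P) + nMedium μ P (allParts μ P) ≡ totalScore P
  2*nLarge+nMedium≡totalScore P = trans (2*nLarge+nMedium≡score P (allParts μ P))
    (sum-cong-≗ (λ i → trans (cong (_* weight (part P i)) (𝟙-yes (i ∈? allParts μ P) (from ∈-tabulate⇔ refl)))
                             (ℕ.*-identityˡ (weight (part P i)))))

  percentile<percentile⇔ : ∀ P Q → percentile μ P < percentile μ Q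
                                  ⇔ (totalScore P + 1) * suc (c Q) ℕ.< (totalScore Q + 1) * suc (c P)
  percentile<percentile⇔ P Q =
    subst₂ (λ sP sQ → percentile μ P < percentile μ Q ⇔ (sP + 1) * suc (c Q) ℕ.< (sQ + 1) * suc (c P))
      (2*nLarge+nMedium≡totalScore P) (2*nLarge+nMedium≡totalScore Q)
      (percentileOf<percentileOf⇔ (nLarge μ P (allParts μ P)) (nMedium μ P (allParts μ P)) (c P)
                                  (nLarge μ Q (allParts μ Q)) (nMedium μ Q (allParts μ Q)) (c Q))

  module _ (P : ValidPartition E S*) (T : Subset (c P)) {k} (partsIn≡2+k : partsIn P T ≡ suc (suc k)) where

    percentile<mergeRatio⇔ : percentile μ P < mergeRatioOf P T
                             ⇔ (totalScore P + 1) * suc k + 2 * suc (c P) ℕ.< score P T * suc (c P)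
    percentile<mergeRatio⇔ =
      subst₂ (λ sP sT → percentile μ P < mergeRatioOf P T ⇔ (sP + 1) * suc k + 2 * suc (c P) ℕ.< sT * suc (c P))
        (2*nLarge+nMedium≡totalScore P) (2*nLarge+nMedium≡score P T)
        (percentileOf<mergeRatio⇔ (nLarge μ P (allParts μ P)) (nMedium μ P (allParts μ P)) (c P)
                                  (nLarge μ P T) (nMedium μ P T) (nSmall μ P T) k partsIn≡2+k)

    mergeRatio<percentile⇔ : mergeRatioOf P T < percentile μ P
                             ⇔ score P T * suc (c P) ℕ.< (totalScore P + 1) * suc k + 2 * suc (c P)
    mergeRatio<percentile⇔ =
      subst₂ (λ sP sT → mergeRatioOf P T < percentile μ P ⇔ sT * suc (c P) ℕ.< (sP + 1) * suc k + 2 * suc (c P))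
        (2*nLarge+nMedium≡totalScore P) (2*nLarge+nMedium≡score P T)
        (mergeRatio<percentileOf⇔ (nLarge μ P (allParts μ P)) (nMedium μ P (allParts μ P)) (c P)
                                  (nLarge μ P T) (nMedium μ P T) (nSmall μ P T) k partsIn≡2+k)

  module Coarsening (μ>0 : ∀ v → 0ℚ < μ v) (P Q : ValidPartition E S*)
                    (f : Fin (c P) → Fin (c Q)) (f-sub : ∀ i → part P i ⊆ part Q (f i)) where

    lab-coarser : ∀ v → lab Q v ≡ Maybe.map f (lab P v)
    lab-coarser v with lab P v in labPv≡
    ... | nothing = to (lab-S* Q v) (from (lab-S* P v) labPv≡)
    ... | just i  = to (∈-partOf⇔ (lab Q)) (f-sub i (from (∈-partOf⇔ (lab P)) labPv≡))

    part-coarser : ∀ j → part Q j ≡ union P (fibre f j)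
    part-coarser j = trans (≡-from-∈⇔ (λ {v} → ∈-partOf⇔ (lab Q) ⟨⇔⟩ relabel v ⟨⇔⟩ ⇔-sym (∈-partOf⇔ (Maybe.map f ∘ lab P))))
                           (partOf-map≡unionOf-fibre (lab P) f j)
      where
      relabel : ∀ v → lab Q v ≡ just j ⇔ Maybe.map f (lab P v) ≡ just j
      relabel v = mk⇔ (trans (sym (lab-coarser v))) (trans (lab-coarser v))

    fibre-inhabited : ∀ j → ∃ λ i → f i ≡ j
    fibre-inhabited j with proj₁ (part-conn Q j)
    ... | v , v∈Qj with to (∈-unionOf⇔ (lab P)) (subst (v ∈_) (part-coarser j) v∈Qj)
    ...   | i , _ , i∈fibre = i , to ∈-fibre⇔ i∈fibre

    fibreSize : Fin (c Q) → ℕ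
    fibreSize j = ∑[ i < c P ] 𝟙 (i ∈? fibre f j)

    fibreScore : Fin (c Q) → ℕ
    fibreScore j = score P (fibre f j)

    fibreSize≥1 : ∀ j → 1 ≤ fibreSize j
    fibreSize≥1 j with fibre-inhabited j
    ... | i , fi≡j = subst (_≤ fibreSize j) (𝟙-∈-fibre {g = f} fi≡j) (term≤∑ (λ i → 𝟙 (i ∈? fibre f j)) i)

    fibres-cover : ∀ i → ∑[ j < c Q ] 𝟙 (i ∈? fibre f j) ≡ 1
    fibres-cover i = trans (∑-single (λ j → 𝟙 (i ∈? fibre f j)) (f i) (λ j j≢fi → 𝟙-∉-fibre {g = f} (j≢fi ∘ sym)))
                           (𝟙-∈-fibre {g = f} {i} refl)

    ∑-fibreSize : ∑[ j < c Q ] fibreSize j ≡ c P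
    ∑-fibreSize = begin
      ∑[ j < c Q ] ∑[ i < c P ] 𝟙 (i ∈? fibre f j) ≡⟨ ∑-comm (λ i j → 𝟙 (i ∈? fibre f j)) ⟨
      ∑[ i < c P ] ∑[ j < c Q ] 𝟙 (i ∈? fibre f j) ≡⟨ sum-cong-≗ fibres-cover ⟩
      ∑[ i < c P ] 1                                 ≡⟨ ∑-const (c P) 1 ⟩
      c P * 1                                        ≡⟨ ℕ.*-identityʳ (c P) ⟩
      c P                                            ∎
      where open ≡-Reasoning

    ∑-fibreScore : ∑[ j < c Q ] fibreScore j ≡ totalScore P
    ∑-fibreScore = begin
      ∑[ j < c Q ] ∑[ i < c P ] (𝟙 (i ∈? fibre f j) * w i)
        ≡⟨ ∑-comm (λ i j → 𝟙 (i ∈? fibre f j) * w i) ⟨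
      ∑[ i < c P ] ∑[ j < c Q ] (𝟙 (i ∈? fibre f j) * w i)
        ≡⟨ sum-cong-≗ (λ i → *-distribʳ-sum (w i) (λ j → 𝟙 (i ∈? fibre f j))) ⟨
      ∑[ i < c P ] (∑[ j < c Q ] 𝟙 (i ∈? fibre f j) * w i)
        ≡⟨ sum-cong-≗ (λ i → trans (cong (_* w i) (fibres-cover i)) (ℕ.*-identityˡ (w i))) ⟩
      ∑[ i < c P ] w i ∎
      where
      open ≡-Reasoning
      w : Fin (c P) → ℕ
      w i = weight (part P i)

    two-members⇒fibreSize≥2 : ∀ {i i' j} → i ≢ i' → f i ≡ j → f i' ≡ j → 2 ≤ fibreSize j
    two-members⇒fibreSize≥2 {i} {i'} {j} i≢i' fi≡j fi'≡j = subst₂ (λ x y → x + y ≤ fibreSize j)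
      (𝟙-∈-fibre {g = f} fi≡j) (𝟙-∈-fibre {g = f} fi'≡j)
      (pair≤∑ (λ i → 𝟙 (i ∈? fibre f j)) i≢i')

    fibreSize≥2⇒another-member : ∀ {i j} → 2 ≤ fibreSize j → f i ≡ j → ∃ λ i' → i' ≢ i × f i' ≡ j
    fibreSize≥2⇒another-member {i} {j} 2≤size fi≡j with any? (λ i' → ¬? (i' Fin.≟ i) ×-dec (f i' Fin.≟ j))
    ... | yes another = another
    ... | no ¬another = ⊥-elim (ℕ.<⇒≱ 2≤size (begin
      fibreSize j        ≡⟨ ∑-single (λ i → 𝟙 (i ∈? fibre f j)) i (λ i' i'≢i → 𝟙-∉-fibre {g = f} (λ fi'≡j → ¬another (i' , i'≢i , fi'≡j))) ⟩
      𝟙 (i ∈? fibre f j) ≡⟨ 𝟙-∈-fibre {g = f} fi≡j ⟩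
      1                  ∎))
      where open ℕ.≤-Reasoning

    singleton-fibre-score : ∀ j → fibreSize j ≡ 1 → fibreScore j ≡ weight (part Q j)
    singleton-fibre-score j size≡1 = begin
      fibreScore j                                ≡⟨ ∑-single _ i₀ (λ i i≢i₀ → cong (_* weight (part P i)) (𝟙-∉-fibre {g = f} (i≢i₀ ∘ unique))) ⟩
      𝟙 (i₀ ∈? fibre f j) * weight (part P i₀)    ≡⟨ cong (_* weight (part P i₀)) (𝟙-∈-fibre {g = f} fi₀≡j) ⟩
      1 * weight (part P i₀)                      ≡⟨ ℕ.*-identityˡ _ ⟩
      weight (part P i₀)                          ≡⟨ cong weight Qj≡Pi₀ ⟨
      weight (part Q j)                           ∎
      where
      open ≡-Reasoning
      i₀ : Fin (c P)
      i₀ = proj₁ (fibre-inhabited j)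
      fi₀≡j : f i₀ ≡ j
      fi₀≡j = proj₂ (fibre-inhabited j)
      unique : ∀ {i} → f i ≡ j → i ≡ i₀
      unique {i} fi≡j with i Fin.≟ i₀
      ... | yes i≡i₀ = i≡i₀
      ... | no i≢i₀  = ⊥-elim (ℕ.<⇒≱ (two-members⇒fibreSize≥2 i≢i₀ fi≡j fi₀≡j) (ℕ.≤-reflexive size≡1))
      Qj≡Pi₀ : part Q j ≡ part P i₀
      Qj≡Pi₀ = trans (part-coarser j) (unionOf-singleton (lab P) (∈-fibre⇔ ⟨⇔⟩ mk⇔ unique (λ { refl → fi₀≡j })))

    plural-fibre-shape : ∀ j → 2 ≤ fibreSize j → weight (part Q j) ≡ 2 ⊎ fibreScore j ≡ 0
    plural-fibre-shape j 2≤size with μ* ℚ.<? measure μ (part Q j)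
    ... | yes μ*<μQj = inj₁ (weight-large μ*<μQj)
    ... | no μ*≮μQj  = inj₂ (trans (sum-cong-≗ term≡0) (sum-replicate-zero (c P)))
      where
      part-smaller : ∀ {i} → f i ≡ j → measure μ (part P i) < measure μ (part Q j)
      part-smaller {i} fi≡j with fibreSize≥2⇒another-member 2≤size fi≡j
      ... | i' , i'≢i , fi'≡j with proj₁ (part-conn P i')
      ...   | u , u∈Pi' = measure-mono-< μ>0 (subst (λ j → part P i ⊆ part Q j) fi≡j (f-sub i))
                            (subst (λ j → u ∈ part Q j) fi'≡j (f-sub i' u∈Pi'))
                            (λ u∈Pi → i'≢i (just-injective (trans (sym (to (∈-partOf⇔ (lab P)) u∈Pi'))
                                                                  (to (∈-partOf⇔ (lab P)) u∈Pi))))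
      term≡0 : ∀ i → 𝟙 (i ∈? fibre f j) * weight (part P i) ≡ 0
      term≡0 i with i ∈? fibre f j
      ... | no _   = refl
      ... | yes i∈ = cong (1 *_) (weight-small (ℚ.<-≤-trans (part-smaller (to ∈-fibre⇔ i∈)) (ℚ.≮⇒≥ μ*≮μQj)))

    plural-witness : ∀ j → fibreSize j ≢ 1 → ∃ λ k → fibreSize j ≡ suc (suc k)
    plural-witness j size≢1 with fibreSize j | fibreSize≥1 j
    ... | suc zero    | _ = ⊥-elim (size≢1 refl)
    ... | suc (suc k) | _ = k , refl

    unique-member⇒fibreSize≡1 : ∀ {j i} → (∀ {i'} → f i' ≡ j → i' ≡ i) → fibreSize j ≡ 1
    unique-member⇒fibreSize≡1 {j} unique with fibreSize j ℕ.≟ 1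
    ... | yes size≡1 = size≡1
    ... | no size≢1 with plural-witness j size≢1
    ...   | k , size≡2+k with fibre-inhabited j
    ...   | i₀ , fi₀≡j with fibreSize≥2⇒another-member (subst (2 ≤_) (sym size≡2+k) (s≤s (s≤s z≤n))) fi₀≡j
    ...     | i' , i'≢i₀ , fi'≡j = ⊥-elim (i'≢i₀ (trans (unique fi'≡j) (sym (unique fi₀≡j))))

    private
      a b : ℕ
      a = totalScore P + 1
      b = suc (c P)

    coarseTerm fineTerm : Fin (c Q) → ℕ
    coarseTerm j = a * fibreSize j + b * weight (part Q j)
    fineTerm j = a + b * fibreScore j

    ∑-coarseTerm : sum coarseTerm ≡ a * c P + b * totalScore Q
    ∑-coarseTerm = begin
      sum coarseTerm
        ≡⟨ ∑-distrib-+ (λ j → a * fibreSize j) (λ j → b * weight (part Q j)) ⟩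
      ∑[ j < c Q ] (a * fibreSize j) + ∑[ j < c Q ] (b * weight (part Q j))
        ≡⟨ cong₂ _+_ (*-distribˡ-sum a fibreSize) (*-distribˡ-sum b (λ j → weight (part Q j))) ⟨
      a * sum fibreSize + b * totalScore Q
        ≡⟨ cong (λ x → a * x + b * totalScore Q) ∑-fibreSize ⟩
      a * c P + b * totalScore Q ∎
      where open ≡-Reasoning

    ∑-fineTerm : sum fineTerm ≡ a * c Q + b * totalScore P
    ∑-fineTerm = begin
      sum fineTerm                                         ≡⟨ ∑-distrib-+ (λ _ → a) (λ j → b * fibreScore j) ⟩
      ∑[ j < c Q ] a + ∑[ j < c Q ] (b * fibreScore j)
        ≡⟨ cong₂ _+_ (trans (∑-const (c Q) a) (ℕ.*-comm (c Q) a)) (sym (*-distribˡ-sum b fibreScore)) ⟩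
      a * c Q + b * sum fibreScore                         ≡⟨ cong (λ x → a * c Q + b * x) ∑-fibreScore ⟩
      a * c Q + b * totalScore P                           ∎
      where open ≡-Reasoning

    percentile<⇔∑coarseTerm<∑fineTerm : percentile μ Q < percentile μ P ⇔ sum coarseTerm ℕ.< sum fineTerm
    percentile<⇔∑coarseTerm<∑fineTerm =
      subst₂ (λ x y → percentile μ Q < percentile μ P ⇔ x ℕ.< y) (sym ∑-coarseTerm) (sym ∑-fineTerm)
      (percentile<percentile⇔ Q P ⟨⇔⟩ cross-<⇔ (totalScore P) (c P) (totalScore Q) (c Q))

    percentile>⇔∑fineTerm<∑coarseTerm : percentile μ P < percentile μ Q ⇔ sum fineTerm ℕ.< sum coarseTerm
    percentile>⇔∑fineTerm<∑coarseTerm =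
      subst₂ (λ x y → percentile μ P < percentile μ Q ⇔ x ℕ.< y) (sym ∑-fineTerm) (sym ∑-coarseTerm)
      (percentile<percentile⇔ P Q ⟨⇔⟩ cross->⇔ (totalScore P) (c P) (totalScore Q) (c Q))

    singleton-fibre-balanced : ∀ j → fibreSize j ≡ 1 → coarseTerm j ≡ fineTerm j
    singleton-fibre-balanced j size≡1 =
      trans (cong₂ (λ k w → a * k + b * w) size≡1 (sym (singleton-fibre-score j size≡1)))
            (cong (_+ b * fibreScore j) (ℕ.*-identityʳ a))

    module _ {j k} (size≡2+k : fibreSize j ≡ suc (suc k)) where

      private
        partsIn≡2+k : partsIn P (fibre f j) ≡ suc (suc k)
        partsIn≡2+k = trans (partsIn≡∑ P (fibre f j)) size≡2+k
        shape : weight (part Q j) ≡ 2 ⊎ fibreScore j ≡ 0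
        shape = plural-fibre-shape j (subst (2 ≤_) (sym size≡2+k) (s≤s (s≤s z≤n)))

      coarseTerm<fineTerm⇔ : coarseTerm j ℕ.< fineTerm j ⇔ percentile μ P < mergeRatioOf P (fibre f j)
      coarseTerm<fineTerm⇔ =
        subst (λ k' → a * k' + b * weight (part Q j) ℕ.< fineTerm j ⇔ percentile μ P < mergeRatioOf P (fibre f j))
              (sym size≡2+k)
              (plural-fibre-<⇔ a b k shape ⟨⇔⟩ ⇔-sym (percentile<mergeRatio⇔ P (fibre f j) partsIn≡2+k))

      fineTerm<coarseTerm⇔ : fineTerm j ℕ.< coarseTerm j ⇔ mergeRatioOf P (fibre f j) < percentile μ P
      fineTerm<coarseTerm⇔ =
        subst (λ k' → fineTerm j ℕ.< a * k' + b * weight (part Q j) ⇔ mergeRatioOf P (fibre f j) < percentile μ P)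
              (sym size≡2+k)
              (plural-fibre->⇔ a b k (ℕ.m≤n+m 1 (totalScore P)) shape
                 ⟨⇔⟩ ⇔-sym (mergeRatio<percentile⇔ P (fibre f j) partsIn≡2+k))

  module _ (μ>0 : ∀ v → 0ℚ < μ v) (P : ValidPartition E S*) where

    module _ {Q : ValidPartition E S*} (P≼Q : Coarser P Q) where

      private
        f : Fin (c P) → Fin (c Q)
        f i = proj₁ (P≼Q i)
      open Coarsening μ>0 P Q f (proj₂ ∘ P≼Q)

      private
        plural-mergeable : ∀ {j k} → fibreSize j ≡ suc (suc k) →
                           2 ≤ partsIn P (fibre f j) × Connected E (union P (fibre f j))
        plural-mergeable {j} size≡2+k = subst (2 ≤_) (sym (trans (partsIn≡∑ P (fibre f j)) size≡2+k)) (s≤s (s≤s z≤n))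
                                      , subst (Connected E) (part-coarser j) (part-conn Q j)

      coarsening-lowers⇒merge-lowers : percentile μ Q < percentile μ P →
        ∃ λ T → 2 ≤ partsIn P T × Connected E (union P T) × percentile μ P < mergeRatioOf P T
      coarsening-lowers⇒merge-lowers Q<P =
        let j , coarse<fine = ∑<∑⇒∃< coarseTerm fineTerm (to percentile<⇔∑coarseTerm<∑fineTerm Q<P)
            _ , size≡2+k = plural-witness j (λ size≡1 → ℕ.<-irrefl (singleton-fibre-balanced j size≡1) coarse<fine)
            2≤partsIn , connected = plural-mergeable size≡2+k
        in  fibre f j , 2≤partsIn , connected , to (coarseTerm<fineTerm⇔ size≡2+k) coarse<fine

      coarsening-raises⇒merge-raises : percentile μ P < percentile μ Q →
        ∃ λ T → 2 ≤ partsIn P T × Connected E (union P T) × mergeRatioOf P T < percentile μ P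
      coarsening-raises⇒merge-raises P<Q =
        let j , fine<coarse = ∑<∑⇒∃< fineTerm coarseTerm (to percentile>⇔∑fineTerm<∑coarseTerm P<Q)
            _ , size≡2+k = plural-witness j (λ size≡1 → ℕ.<-irrefl (sym (singleton-fibre-balanced j size≡1)) fine<coarse)
            2≤partsIn , connected = plural-mergeable size≡2+k
        in  fibre f j , 2≤partsIn , connected , to (fineTerm<coarseTerm⇔ size≡2+k) fine<coarse

    module _ (T : Subset (c P)) (2≤partsIn : 2 ≤ partsIn P T) (conn : Connected E (union P T)) where

      private
        Q : ValidPartition E S*
        Q = merged P T conn
      open Coarsening μ>0 P Q (merge T) (merged-coarser P T conn)

      private
        surplus : ℕ
        surplus = proj₁ (2≤⇒≡2+ 2≤partsIn)
        merged-fibreSize : fibreSize zero ≡ suc (suc surplus)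
        merged-fibreSize = trans (cong (λ T' → ∑[ i < c P ] 𝟙 (i ∈? T')) (merge-fibre-zero P T))
                                 (trans (sym (partsIn≡∑ P T)) (proj₂ (2≤⇒≡2+ 2≤partsIn)))
        others-balanced : ∀ r → coarseTerm (suc r) ≡ fineTerm (suc r)
        others-balanced r = singleton-fibre-balanced (suc r)
          (unique-member⇒fibreSize≡1 (λ eq → to (proj₂ (merge-fibre-suc P T r)) (from ∈-fibre⇔ eq)))
        coarser : Coarser P Q
        coarser i = merge T i , merged-coarser P T conn i

      merge-lowers⇒coarsening-lowers : percentile μ P < mergeRatioOf P T →
                                       ∃ λ Q → Coarser P Q × percentile μ Q < percentile μ P
      merge-lowers⇒coarsening-lowers P<merge = Q , coarser , from percentile<⇔∑coarseTerm<∑fineTerm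
        (ℕ.+-mono-<-≤ (from (coarseTerm<fineTerm⇔ merged-fibreSize)
                         (subst (λ T' → percentile μ P < mergeRatioOf P T') (sym (merge-fibre-zero P T)) P<merge))
                      (ℕ.≤-reflexive (sum-cong-≗ others-balanced)))

      merge-raises⇒coarsening-raises : mergeRatioOf P T < percentile μ P →
                                       ∃ λ Q → Coarser P Q × percentile μ P < percentile μ Q
      merge-raises⇒coarsening-raises merge<P = Q , coarser , from percentile>⇔∑fineTerm<∑coarseTerm
        (ℕ.+-mono-<-≤ (from (fineTerm<coarseTerm⇔ merged-fibreSize)
                         (subst (λ T' → mergeRatioOf P T' < percentile μ P) (sym (merge-fibre-zero P T)) merge<P))
                      (ℕ.≤-reflexive (sym (sum-cong-≗ others-balanced))))

lemma3 : ∀ {n : ℕ} (E : Fin n → Fin n → Set) → Reflexive E → Symmetric E →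
         (μ : Fin n → ℚ) → (∀ v → 0ℚ < μ v) →
         (S* : Subset n) → (Empty S* ⊎ Connected E S*) →
         (P₀ : ValidPartition E S*) →
         ((∃ λ (Q : ValidPartition E S*) → Coarser P₀ Q × percentile μ Q < percentile μ P₀)
           ⇔ (∃ λ (T : Subset (c P₀)) →
                (2 ≤ nLarge μ P₀ T +ℕ nMedium μ P₀ T +ℕ nSmall μ P₀ T)
                × Connected E (union P₀ T)
                × percentile μ P₀ < mergeRatio (nLarge μ P₀ T) (nMedium μ P₀ T) (nSmall μ P₀ T)))
         ×
         ((∃ λ (Q : ValidPartition E S*) → Coarser P₀ Q × percentile μ P₀ < percentile μ Q)
           ⇔ (∃ λ (T : Subset (c P₀)) →
                (2 ≤ nLarge μ P₀ T +ℕ nMedium μ P₀ T +ℕ nSmall μ P₀ T)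
                × Connected E (union P₀ T)
                × mergeRatio (nLarge μ P₀ T) (nMedium μ P₀ T) (nSmall μ P₀ T) < percentile μ P₀))
lemma3 E _ _ μ μ>0 S* _ P₀ =
    mk⇔ (λ (Q , P₀≼Q , Q<P₀) → coarsening-lowers⇒merge-lowers μ>0 P₀ {Q} P₀≼Q Q<P₀)
        (λ (T , 2≤ , conn , P₀<merge) → merge-lowers⇒coarsening-lowers μ>0 P₀ T 2≤ conn P₀<merge)
  , mk⇔ (λ (Q , P₀≼Q , P₀<Q) → coarsening-raises⇒merge-raises μ>0 P₀ {Q} P₀≼Q P₀<Q)
        (λ (T , 2≤ , conn , merge<P₀) → merge-raises⇒coarsening-raises μ>0 P₀ T 2≤ conn merge<P₀)
  where open Percentiles {E = E} {S* = S*} μ
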